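{- Let $\Gamma=(G,\sigma)$ be a signed graph and $\mu$ a positive measure on $V$. Then $$h^{\sigma}_1(\mu)=\min_{\sigma'\in [\sigma]}\ \min_{\emptyset\neq S\subseteq V}\rho^{\sigma'}(S).$$
   Context: A signed graph $\Gamma=(G,\sigma)$ consists of a finite simple undirected graph $G=(V,E)$, positive symmetric edge weights $w_{uv}>0$ for $\{u,v\}\in E$ ($w_{uv}=0$ otherwise), and a signature $\sigma:E\to\{+1,-1\}$; write $\sigma(uv)=\sigma(\{u,v\})$. For $\theta:V\to\{\pm1\}$, $\sigma^\theta(uv)=\theta(u)\sigma(uv)\theta(v)$; the switching class $[\sigma]$ is $\{\sigma^\theta:\theta:V\to\{\pm1\}\}$. For a positive measure $\mu$, $\mathrm{vol}_\mu(S)=\sum_{u\in S}\mu(u)$. For $V_1,V_2\subseteq V$, $|E(V_1,V_2)|=\sum_{u\in V_1}\sum_{v\in V_2}w_{uv}$, $|E^{\pm}(V_1,V_2)|=\sum_{u\in V_1}\sum_{v\in V_2,\sigma(uv)=\pm1}w_{uv}$, $|E^\pm(V_1)|=|E^\pm(V_1,V_1)|$. For disjoint $V_1,V_2$ with $V_1\cup V_2\ne\emptyset$, $$\beta^{\sigma}(V_1,V_2)=\frac{2|E^{+}(V_1,V_2)|+|E^-(V_1)|+|E^-(V_2)|+|E(V_1\cup V_2,\overline{V_1\cup V_2})|}{\mathrm{vol}_{\mu}(V_1\cup V_2)},$$ and $h_1^\sigma(\mu)$ is its minimum over all such pairs. For a signature $\sigma'$ and $\emptyset\neq S\subseteq V$,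 the signed expansion is $\rho^{\sigma'}(S)=\frac{|E^-(S)|+|E(S,\overline S)|}{\mathrm{vol}_\mu(S)}$, where $|E^-(S)|$ is computed with respect to $\sigma'$.
   Formalization: The edge weights and the positive measure μ take rational values rather than real ones. -}

module Defs where

open import Data.Nat using (ℕ; zero; suc)
open import Data.Fin using (Fin; zero; suc)
open import Data.Fin.Subset using (Subset; _∪_; _∩_; ∁; Nonempty; Empty)
open import Data.Vec using (lookup)
open import Data.Bool using (if_then_else_)
open import Data.Sign using (Sign) renaming (_*_ to _·_)
import Data.Sign.Properties as SignP
open import Data.Rational using (ℚ; 0ℚ; _+_; _*_; _÷_; _<_; _≤_; ≢-nonZero)
open import Data.Rational.Properties using (_≟_)
open import Data.Product using (Σ; _×_; ∃-syntax)
open import Relation.Nullary using (yes; no)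
open import Relation.Binary.PropositionalEquality using (_≡_)

-- A finite simple undirected weighted graph on vertex set Fin n:
-- w u v > 0 iff {u,v} is an edge (with weight w u v), w u v = 0 otherwise.
-- A signature is a symmetric function σ : Fin n → Fin n → Sign; its
-- values on non-edges are irrelevant (they are always multiplied by w = 0).
record SignedGraph (n : ℕ) : Set where
  field
    w       : Fin n → Fin n → ℚ
    σ       : Fin n → Fin n → Sign
    w-sym   : ∀ u v → w u v ≡ w v u
    w-nonneg : ∀ u v → 0ℚ ≤ w u v
    w-loop  : ∀ u → w u u ≡ 0ℚ
    σ-sym   : ∀ u v → σ u v ≡ σ v u

sumFin : ∀ {n} → (Fin n → ℚ) → ℚ
sumFin {zero}  f = 0ℚ
sumFin {suc n} f = f zero + sumFin (λ i → f (suc i))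

sumIn : ∀ {n} → Subset n → (Fin n → ℚ) → ℚ
sumIn p f = sumFin (λ u → if lookup p u then f u else 0ℚ)

-- Division, total (returns 0 for a zero denominator; only ever applied
-- to volumes of nonempty sets, which are positive).
_/′_ : ℚ → ℚ → ℚ
a /′ b with b ≟ 0ℚ
... | yes _ = 0ℚ
... | no b≢0 = _÷_ a b {{≢-nonZero b≢0}}

switch : ∀ {n} → (Fin n → Fin n → Sign) → (Fin n → Sign) → Fin n → Fin n → Sign
switch σ θ u v = (θ u · σ u v) · θ v

keepIf : Sign → Sign → ℚ → ℚ
keepIf s t x with s SignP.≟ t
... | yes _ = x
... | no  _ = 0ℚ

module _ {n : ℕ} (w : Fin n → Fin n → ℚ) where

  vol : (Fin n → ℚ) → Subset n → ℚ
  vol μ S = sumIn S μ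

  E : Subset n → Subset n → ℚ
  E V₁ V₂ = sumIn V₁ (λ u → sumIn V₂ (λ v → w u v))

  Esign : (Fin n → Fin n → Sign) → Sign → Subset n → Subset n → ℚ
  Esign σ s V₁ V₂ = sumIn V₁ (λ u → sumIn V₂ (λ v → keepIf (σ u v) s (w u v)))

  β : (Fin n → ℚ) → (Fin n → Fin n → Sign) → Subset n → Subset n → ℚ
  β μ σ V₁ V₂ =
    ((((Esign σ Sign.+ V₁ V₂ + Esign σ Sign.+ V₁ V₂)
       + Esign σ Sign.- V₁ V₁) + Esign σ Sign.- V₂ V₂)
       + E (V₁ ∪ V₂) (∁ (V₁ ∪ V₂)))
    /′ vol μ (V₁ ∪ V₂)

  ρ : (Fin n → ℚ) → (Fin n → Fin n → Sign) → Subset n → ℚ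
  ρ μ σ′ S = (Esign σ′ Sign.- S S + E S (∁ S)) /′ vol μ S

  IsH₁ : (Fin n → ℚ) → (Fin n → Fin n → Sign) → ℚ → Set
  IsH₁ μ σ m =
    (Σ (Subset n) λ V₁ → Σ (Subset n) λ V₂ →
       Empty (V₁ ∩ V₂) × Nonempty (V₁ ∪ V₂) × β μ σ V₁ V₂ ≡ m)
    × (∀ V₁ V₂ → Empty (V₁ ∩ V₂) → Nonempty (V₁ ∪ V₂) → m ≤ β μ σ V₁ V₂)

  IsMinSwitchedρ : (Fin n → ℚ) → (Fin n → Fin n → Sign) → ℚ → Set
  IsMinSwitchedρ μ σ m =
    (Σ (Fin n → Sign) λ θ → Σ (Subset n) λ S →
       Nonempty S × ρ μ (switch σ θ) S ≡ m)
    × (∀ (θ : Fin n → Sign) S → Nonempty S → m ≤ ρ μ (switch σ θ) S)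

{-# OPTIONS --safe #-}
-- Switching by θ = + on V₁ and θ = - on V₂ keeps the signs of edges inside
-- V₁ and inside V₂ and flips those between V₁ and V₂.  Hence the negative edges
-- of σ^θ inside V₁ ∪ V₂ are the negative edges of σ inside V₁ or V₂ together
-- with the positive edges of σ between V₁ and V₂, the latter counted once in
-- each direction, so β^σ(V₁,V₂) = ρ^{σ^θ}(V₁ ∪ V₂).  Conversely every pair
-- (θ, S) arises in this way from V₁ = S ∩ θ⁻¹(+), V₂ = S ∩ θ⁻¹(-), so both
-- minimisation problems range over the same set of values.
module Submission where

open import Defs
open import Data.Nat using (ℕ; zero; suc)
open import Data.Fin using (Fin; zero; suc)
open import Data.Fin.Subset using (Subset; ⊤; _∪_; _∩_; ∁; _∈_; _∉_; Nonempty; Empty)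
open import Data.Fin.Subset.Properties
  using (x∈p∩q⁺; x∈p∩q⁻; x∈∁p⇒x∉p; ∩-distribˡ-∪; ∪-inverseʳ; ∩-identityʳ)
open import Data.Vec using (lookup; tabulate)
open import Data.Vec.Properties using (lookup-zipWith; lookup∘tabulate; lookup⇒[]=; []=⇒lookup)
open import Data.Bool using (true; false; if_then_else_; _∨_)
open import Data.Sign using (Sign; opposite) renaming (_*_ to _·_)
import Data.Sign.Properties as Sign
open import Data.Rational using (ℚ; 0ℚ; _<_; _+_; _≤_)
open import Data.Rational.Properties using (+-identityʳ; +-identityˡ; +-0-commutativeMonoid)
open import Algebra.Bundles using (CommutativeMonoid)
open import Algebra.Properties.CommutativeSemigroup
  (CommutativeMonoid.commutativeSemigroup +-0-commutativeMonoid) using (interchange)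
open import Data.Rational.Solver using (module +-*-Solver)
open import Data.Product using (_×_; _,_; proj₂)
open import Data.Empty using (⊥-elim)
open import Function using (_∘_)
open import Relation.Nullary using (does)
open import Relation.Binary.PropositionalEquality
open ≡-Reasoning

sumFin-cong : ∀ {n} {f g : Fin n → ℚ} → f ≗ g → sumFin f ≡ sumFin g
sumFin-cong {zero}  _   = refl
sumFin-cong {suc n} f≗g = cong₂ _+_ (f≗g zero) (sumFin-cong (f≗g ∘ suc))

sumFin-0 : ∀ n → sumFin {n} (λ _ → 0ℚ) ≡ 0ℚ
sumFin-0 zero    = refl
sumFin-0 (suc n) = cong (0ℚ +_) (sumFin-0 n)

sumFin-distrib-+ : ∀ {n} (f g : Fin n → ℚ) →
                   sumFin (λ u → f u + g u) ≡ sumFin f + sumFin g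
sumFin-distrib-+ {zero}  f g = refl
sumFin-distrib-+ {suc n} f g =
  trans (cong (f zero + g zero +_) (sumFin-distrib-+ (f ∘ suc) (g ∘ suc)))
        (interchange (f zero) (g zero) _ _)

sumFin-swap : ∀ {m n} (f : Fin m → Fin n → ℚ) →
              sumFin (λ u → sumFin (f u)) ≡ sumFin (λ v → sumFin (λ u → f u v))
sumFin-swap {zero}  {n} f = sym (sumFin-0 n)
sumFin-swap {suc m} f = begin
  sumFin (f zero) + sumFin (λ u → sumFin (f (suc u)))
    ≡⟨ cong (sumFin (f zero) +_) (sumFin-swap (f ∘ suc)) ⟩
  sumFin (f zero) + sumFin (λ v → sumFin (λ u → f (suc u) v))
    ≡⟨ sumFin-distrib-+ (f zero) _ ⟨
  sumFin (λ v → f zero v + sumFin (λ u → f (suc u) v)) ∎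

zeroOutside : ∀ {n} → Subset n → (Fin n → ℚ) → Fin n → ℚ
zeroOutside S f u = if lookup S u then f u else 0ℚ

sumIn-cong : ∀ {n} (S : Subset n) {f g : Fin n → ℚ} →
             (∀ {u} → u ∈ S → f u ≡ g u) → sumIn S f ≡ sumIn S g
sumIn-cong S {f} {g} f≡g = sumFin-cong pointwise
  where
  pointwise : zeroOutside S f ≗ zeroOutside S g
  pointwise u with lookup S u in u∈S
  ... | true  = f≡g (lookup⇒[]= u S u∈S)
  ... | false = refl

sumIn-distrib-+ : ∀ {n} (S : Subset n) (f g : Fin n → ℚ) →
                  sumIn S (λ u → f u + g u) ≡ sumIn S f + sumIn S g
sumIn-distrib-+ S f g =
  trans (sumFin-cong pointwise) (sumFin-distrib-+ (zeroOutside S f) (zeroOutside S g))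
  where
  pointwise : ∀ u → zeroOutside S (λ v → f v + g v) u ≡ zeroOutside S f u + zeroOutside S g u
  pointwise u with lookup S u
  ... | true  = refl
  ... | false = refl

sumIn-∪ : ∀ {n} {p q : Subset n} (f : Fin n → ℚ) → Empty (p ∩ q) →
          sumIn (p ∪ q) f ≡ sumIn p f + sumIn q f
sumIn-∪ {p = p} {q} f disjoint =
  trans (sumFin-cong pointwise) (sumFin-distrib-+ (zeroOutside p f) (zeroOutside q f))
  where
  pointwise : ∀ u → zeroOutside (p ∪ q) f u ≡ zeroOutside p f u + zeroOutside q f u
  pointwise u rewrite lookup-zipWith _∨_ u p q with lookup p u in u∈p | lookup q u in u∈q
  ... | true  | true  = ⊥-elim (disjoint (u , x∈p∩q⁺ (lookup⇒[]= u p u∈p , lookup⇒[]= u q u∈q)))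
  ... | true  | false = sym (+-identityʳ (f u))
  ... | false | true  = sym (+-identityˡ (f u))
  ... | false | false = refl

sumIn-swap : ∀ {n} (A B : Subset n) (f : Fin n → Fin n → ℚ) →
             sumIn A (λ u → sumIn B (f u)) ≡ sumIn B (λ v → sumIn A (λ u → f u v))
sumIn-swap A B f = begin
  sumFin (zeroOutside A (λ u → sumFin (zeroOutside B (f u))))
    ≡⟨ sumFin-cong (λ u → zeroOutside-sumFin A u (zeroOutside B (f u))) ⟩
  sumFin (λ u → sumFin (λ v → zeroOutside A (λ u → zeroOutside B (f u) v) u))
    ≡⟨ sumFin-swap (λ u v → zeroOutside A (λ u → zeroOutside B (f u) v) u) ⟩
  sumFin (λ v → sumFin (λ u → zeroOutside A (λ u → zeroOutside B (f u) v) u))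
    ≡⟨ sumFin-cong (λ v → sumFin-cong (λ u → zeroOutside-comm u v)) ⟩
  sumFin (λ v → sumFin (λ u → zeroOutside B (λ v → zeroOutside A (λ u → f u v) u) v))
    ≡⟨ sumFin-cong (λ v → zeroOutside-sumFin B v (zeroOutside A (λ u → f u v))) ⟨
  sumFin (zeroOutside B (λ v → sumFin (zeroOutside A (λ u → f u v)))) ∎
  where
  zeroOutside-sumFin : ∀ {n} (S : Subset n) u (g : Fin n → ℚ) →
    zeroOutside S (λ _ → sumFin g) u ≡ sumFin (λ v → zeroOutside S (λ _ → g v) u)
  zeroOutside-sumFin {n} S u g with lookup S u
  ... | true  = refl
  ... | false = sym (sumFin-0 n)

  zeroOutside-comm : ∀ u v → zeroOutside A (λ u → zeroOutside B (f u) v) u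
                           ≡ zeroOutside B (λ v → zeroOutside A (λ u → f u v) u) v
  zeroOutside-comm u v with lookup A u | lookup B v
  ... | true  | true  = refl
  ... | true  | false = refl
  ... | false | true  = refl
  ... | false | false = refl

keepIf-switch-same : ∀ a s t x → keepIf ((a · s) · a) t x ≡ keepIf s t x
keepIf-switch-same Sign.+ Sign.+ t x = refl
keepIf-switch-same Sign.+ Sign.- t x = refl
keepIf-switch-same Sign.- Sign.+ t x = refl
keepIf-switch-same Sign.- Sign.- t x = refl

keepIf-switch-opposite : ∀ a s x → keepIf ((a · s) · opposite a) Sign.- x ≡ keepIf s Sign.+ x
keepIf-switch-opposite Sign.+ Sign.+ x = refl
keepIf-switch-opposite Sign.+ Sign.- x = refl
keepIf-switch-opposite Sign.- Sign.+ x = refl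
keepIf-switch-opposite Sign.- Sign.- x = refl

Esign-cong : ∀ {n} (w : Fin n → Fin n → ℚ) σ σ′ s t {A B : Subset n} →
             (∀ {u v} → u ∈ A → v ∈ B → keepIf (σ u v) s (w u v) ≡ keepIf (σ′ u v) t (w u v)) →
             Esign w σ s A B ≡ Esign w σ′ t A B
Esign-cong w σ σ′ s t {A} {B} eq = sumIn-cong A (λ u∈A → sumIn-cong B (eq u∈A))

module _ {n : ℕ} (w : Fin n → Fin n → ℚ) (σ : Fin n → Fin n → Sign) where

  Esign-∪ˡ : ∀ s {p q : Subset n} B → Empty (p ∩ q) →
             Esign w σ s (p ∪ q) B ≡ Esign w σ s p B + Esign w σ s q B
  Esign-∪ˡ s B = sumIn-∪ _

  Esign-∪ʳ : ∀ s A {p q : Subset n} → Empty (p ∩ q) →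
             Esign w σ s A (p ∪ q) ≡ Esign w σ s A p + Esign w σ s A q
  Esign-∪ʳ s A disjoint =
    trans (sumIn-cong A (λ _ → sumIn-∪ _ disjoint)) (sumIn-distrib-+ A _ _)

  Esign-sym : (∀ u v → w u v ≡ w v u) → (∀ u v → σ u v ≡ σ v u) →
              ∀ s A B → Esign w σ s A B ≡ Esign w σ s B A
  Esign-sym w-sym σ-sym s A B = trans (sumIn-swap A B _)
    (sumIn-cong B λ {v} _ → sumIn-cong A λ {u} _ →
       cong₂ (λ r x → keepIf r s x) (σ-sym u v) (w-sym u v))

  module _ {θ : Fin n → Sign} {A B : Subset n} (a : Sign) (θ≡a : ∀ {u} → u ∈ A → θ u ≡ a) where

    Esign-switch-same : ∀ s → (∀ {v} → v ∈ B → θ v ≡ a) →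
                        Esign w (switch σ θ) s A B ≡ Esign w σ s A B
    Esign-switch-same s θ≡aᴮ = Esign-cong w (switch σ θ) σ s s λ {u} {v} u∈A v∈B →
      trans (cong₂ (λ b c → keepIf ((b · σ u v) · c) s (w u v)) (θ≡a u∈A) (θ≡aᴮ v∈B))
            (keepIf-switch-same a (σ u v) s (w u v))

    Esign-switch-opposite : (∀ {v} → v ∈ B → θ v ≡ opposite a) →
                            Esign w (switch σ θ) Sign.- A B ≡ Esign w σ Sign.+ A B
    Esign-switch-opposite θ≡-aᴮ = Esign-cong w (switch σ θ) σ Sign.- Sign.+ λ {u} {v} u∈A v∈B →
      trans (cong₂ (λ b c → keepIf ((b · σ u v) · c) Sign.- (w u v)) (θ≡a u∈A) (θ≡-aᴮ v∈B))
            (keepIf-switch-opposite a (σ u v) (w u v))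

separated-by-sign : ∀ {n} {θ : Fin n → Sign} {V₁ V₂ : Subset n} →
                    (∀ {u} → u ∈ V₁ → θ u ≡ Sign.+) → (∀ {u} → u ∈ V₂ → θ u ≡ Sign.-) →
                    Empty (V₁ ∩ V₂)
separated-by-sign {V₁ = V₁} {V₂} θ≡+ θ≡- (u , u∈V₁∩V₂)
  with x∈p∩q⁻ V₁ V₂ u∈V₁∩V₂
... | u∈V₁ , u∈V₂ with () ← trans (sym (θ≡+ u∈V₁)) (θ≡- u∈V₂)

signOf : ∀ {n} → Subset n → Fin n → Sign
signOf p u = if lookup p u then Sign.+ else Sign.-

signOf-∈ : ∀ {n} {p : Subset n} {u} → u ∈ p → signOf p u ≡ Sign.+
signOf-∈ u∈p rewrite []=⇒lookup u∈p = refl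

signOf-∉ : ∀ {n} {p : Subset n} {u} → u ∉ p → signOf p u ≡ Sign.-
signOf-∉ {p = p} {u} u∉p with lookup p u in u∈p
... | true  = ⊥-elim (u∉p (lookup⇒[]= u p u∈p))
... | false = refl

positives : ∀ {n} → (Fin n → Sign) → Subset n
positives θ = tabulate (λ u → does (θ u Sign.≟ Sign.+))

∈-positives⁻ : ∀ {n} (θ : Fin n → Sign) {u} → u ∈ positives θ → θ u ≡ Sign.+
∈-positives⁻ θ {u} u∈P
  with θ u | trans (sym (lookup∘tabulate (λ v → does (θ v Sign.≟ Sign.+)) u)) ([]=⇒lookup u∈P)
... | Sign.+ | _ = refl

∉-positives⁻ : ∀ {n} (θ : Fin n → Sign) {u} → u ∉ positives θ → θ u ≡ Sign.-
∉-positives⁻ θ {u} u∉P with θ u in θu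
... | Sign.- = refl
... | Sign.+ = ⊥-elim (u∉P (lookup⇒[]= u (positives θ)
                 (trans (lookup∘tabulate _ u) (cong (λ s → does (s Sign.≟ Sign.+)) θu))))

p∩q∪p∩∁q≡p : ∀ {n} (p q : Subset n) → (p ∩ q) ∪ (p ∩ ∁ q) ≡ p
p∩q∪p∩∁q≡p p q = begin
  (p ∩ q) ∪ (p ∩ ∁ q) ≡⟨ ∩-distribˡ-∪ p q (∁ q) ⟨
  p ∩ (q ∪ ∁ q)       ≡⟨ cong (p ∩_) (∪-inverseʳ q) ⟩
  p ∩ ⊤               ≡⟨ ∩-identityʳ p ⟩
  p                   ∎

module _ {n : ℕ} (θ : Fin n → Sign) (S : Subset n) where

  ∈-S∩positives⁻ : ∀ {u} → u ∈ S ∩ positives θ → θ u ≡ Sign.+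
  ∈-S∩positives⁻ u∈ = ∈-positives⁻ θ (proj₂ (x∈p∩q⁻ S _ u∈))

  ∈-S∩∁positives⁻ : ∀ {u} → u ∈ S ∩ ∁ (positives θ) → θ u ≡ Sign.-
  ∈-S∩∁positives⁻ u∈ = ∉-positives⁻ θ (x∈∁p⇒x∉p (proj₂ (x∈p∩q⁻ S _ u∈)))

  sign-split-disjoint : Empty ((S ∩ positives θ) ∩ (S ∩ ∁ (positives θ)))
  sign-split-disjoint = separated-by-sign ∈-S∩positives⁻ ∈-S∩∁positives⁻

module _ {n : ℕ} (Γ : SignedGraph n) (μ : Fin n → ℚ) where
  open SignedGraph Γ

  β≡ρ-switch : ∀ (θ : Fin n → Sign) (V₁ V₂ : Subset n) →
               (∀ {u} → u ∈ V₁ → θ u ≡ Sign.+) → (∀ {u} → u ∈ V₂ → θ u ≡ Sign.-) →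
               β w μ σ V₁ V₂ ≡ ρ w μ (switch σ θ) (V₁ ∪ V₂)
  β≡ρ-switch θ V₁ V₂ θ≡+ θ≡- =
    cong (λ x → (x + E w S (∁ S)) /′ vol w μ S) (sym negative-edges)
    where
    S = V₁ ∪ V₂
    disjoint = separated-by-sign θ≡+ θ≡-
    Eθ⁻ = Esign w (switch σ θ) Sign.-
    P = Esign w σ Sign.+ V₁ V₂

    negative-edges : Eθ⁻ S S ≡ ((P + P) + Esign w σ Sign.- V₁ V₁) + Esign w σ Sign.- V₂ V₂
    negative-edges = begin
      Eθ⁻ S S
        ≡⟨ Esign-∪ˡ w (switch σ θ) Sign.- S disjoint ⟩
      Eθ⁻ V₁ S + Eθ⁻ V₂ S
        ≡⟨ cong₂ _+_ (Esign-∪ʳ w (switch σ θ) Sign.- V₁ disjoint)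
                     (Esign-∪ʳ w (switch σ θ) Sign.- V₂ disjoint) ⟩
      (Eθ⁻ V₁ V₁ + Eθ⁻ V₁ V₂) + (Eθ⁻ V₂ V₁ + Eθ⁻ V₂ V₂)
        ≡⟨ cong₂ _+_
             (cong₂ _+_ (Esign-switch-same w σ Sign.+ θ≡+ Sign.- θ≡+)
                        (Esign-switch-opposite w σ Sign.+ θ≡+ θ≡-))
             (cong₂ _+_ (trans (Esign-switch-opposite w σ Sign.- θ≡- θ≡+)
                               (Esign-sym w σ w-sym σ-sym Sign.+ V₂ V₁))
                        (Esign-switch-same w σ Sign.- θ≡- Sign.- θ≡-)) ⟩
      (Esign w σ Sign.- V₁ V₁ + P) + (P + Esign w σ Sign.- V₂ V₂)
        ≡⟨ rearrange _ P _ ⟩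
      ((P + P) + Esign w σ Sign.- V₁ V₁) + Esign w σ Sign.- V₂ V₂ ∎
      where
      open +-*-Solver
      rearrange : ∀ a p d → (a + p) + (p + d) ≡ ((p + p) + a) + d
      rearrange = solve 3 (λ a p d → (a :+ p) :+ (p :+ d) := ((p :+ p) :+ a) :+ d) refl

  β≡ρ-switch-signOf : ∀ {V₁ V₂ : Subset n} → Empty (V₁ ∩ V₂) →
                      β w μ σ V₁ V₂ ≡ ρ w μ (switch σ (signOf V₁)) (V₁ ∪ V₂)
  β≡ρ-switch-signOf {V₁} {V₂} disjoint = β≡ρ-switch (signOf V₁) V₁ V₂ signOf-∈
    (λ u∈V₂ → signOf-∉ (λ u∈V₁ → disjoint (_ , x∈p∩q⁺ (u∈V₁ , u∈V₂))))

  β≡ρ-switch-positives : ∀ θ S →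
                         β w μ σ (S ∩ positives θ) (S ∩ ∁ (positives θ)) ≡ ρ w μ (switch σ θ) S
  β≡ρ-switch-positives θ S = trans
    (β≡ρ-switch θ (S ∩ positives θ) (S ∩ ∁ (positives θ))
      (∈-S∩positives⁻ θ S) (∈-S∩∁positives⁻ θ S))
    (cong (ρ w μ (switch σ θ)) (p∩q∪p∩∁q≡p S (positives θ)))

-- The positivity of μ is not needed: β and ρ agree as fractions, denominators
-- included, so the identity also holds for the junk value of _/′_ at 0.
corollary3p3 : ∀ {n : ℕ} (Γ : SignedGraph n) (μ : Fin n → ℚ)
    → (∀ u → 0ℚ < μ u)
    → ∀ (m : ℚ)
    → (IsH₁ (SignedGraph.w Γ) μ (SignedGraph.σ Γ) m
         → IsMinSwitchedρ (SignedGraph.w Γ) μ (SignedGraph.σ Γ) m)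
      × (IsMinSwitchedρ (SignedGraph.w Γ) μ (SignedGraph.σ Γ) m
         → IsH₁ (SignedGraph.w Γ) μ (SignedGraph.σ Γ) m)
corollary3p3 Γ μ _ m = h₁⇒minρ , minρ⇒h₁
  where
  open SignedGraph Γ

  sign-split-nonempty : ∀ θ S → Nonempty S → Nonempty ((S ∩ positives θ) ∪ (S ∩ ∁ (positives θ)))
  sign-split-nonempty θ S = subst Nonempty (sym (p∩q∪p∩∁q≡p S (positives θ)))

  h₁⇒minρ : IsH₁ w μ σ m → IsMinSwitchedρ w μ σ m
  h₁⇒minρ ((V₁ , V₂ , disjoint , nonempty , β≡m) , m≤β) =
    (signOf V₁ , V₁ ∪ V₂ , nonempty , trans (sym (β≡ρ-switch-signOf Γ μ disjoint)) β≡m) ,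
    λ θ S S≢∅ → subst (m ≤_) (β≡ρ-switch-positives Γ μ θ S)
                  (m≤β _ _ (sign-split-disjoint θ S) (sign-split-nonempty θ S S≢∅))

  minρ⇒h₁ : IsMinSwitchedρ w μ σ m → IsH₁ w μ σ m
  minρ⇒h₁ ((θ , S , S≢∅ , ρ≡m) , m≤ρ) =
    (S ∩ positives θ , S ∩ ∁ (positives θ) ,
     sign-split-disjoint θ S , sign-split-nonempty θ S S≢∅ ,
     trans (β≡ρ-switch-positives Γ μ θ S) ρ≡m) ,
    λ V₁ V₂ disjoint nonempty → subst (m ≤_) (sym (β≡ρ-switch-signOf Γ μ disjoint))
                                  (m≤ρ (signOf V₁) (V₁ ∪ V₂) nonempty)
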